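{- (i) For every $n\ge1$ and every integer $q\ge2$, $\mathrm{DI}(\mathbf{ETHR}_n^n,q)\le 2$. (ii) For every $n\ge2$ and every integer $q\ge n+2$, $\mathrm{DI}(\mathbf{ETHR}_n^{n-1},q)\le 3$.
   Context: For a predicate $P:\mathcal X\times\mathcal Y\to\{0,1\}$ (finite sets) and integer $q\ge2$, an inner product encoding of $P$ modulo $q$ of length $\ell$ is a pair of maps $x\mapsto \vec x\in\mathbb Z_q^\ell$, $y\mapsto\vec y\in\mathbb Z_q^\ell$ such that for all $x,y$: $P(x,y)=1$ iff $\sum_{i=1}^\ell\vec x_i\vec y_i\equiv0\pmod q$; $\mathrm{DI}(P,q)$ is the minimum such $\ell$. For $t\in[n]$, the exact threshold predicate $\mathbf{ETHR}_n^t:2^{[n]}\times2^{[n]}\to\{0,1\}$ is $\mathbf{ETHR}_n^t(S,T)=1$ iff $|S\cap T|=t$. -}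

module Defs where

open import Data.Nat using (ℕ; zero; suc; _*_; _+_; _≤_; _≡ᵇ_)
open import Data.Nat.Divisibility using (_∣_)
open import Data.Fin using (Fin; toℕ) renaming (zero to fz; suc to fs)
open import Data.Fin.Subset using (Subset; _∩_; ∣_∣)
open import Data.Bool using (Bool; true; false)
open import Data.Product using (Σ; _×_; ∃-syntax)
open import Relation.Binary.PropositionalEquality using (_≡_)
open import Function.Bundles using (_⇔_)

sumFin : (ℓ : ℕ) → (Fin ℓ → ℕ) → ℕ
sumFin zero    f = 0
sumFin (suc ℓ) f = f fz + sumFin ℓ (λ i → f (fs i))

-- Elements of Z_q are represented by Fin q (residues 0,…,q-1).
-- The inner product of two vectors in Z_q^ℓ is ≡ 0 (mod q).
IPZero : (q ℓ : ℕ) → (Fin ℓ → Fin q) → (Fin ℓ → Fin q) → Set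
IPZero q ℓ u v = q ∣ sumFin ℓ (λ i → toℕ (u i) * toℕ (v i))

IPEncoding : {X Y : Set} → (X → Y → Bool) → (q ℓ : ℕ) → Set
IPEncoding {X} {Y} P q ℓ =
  Σ (X → Fin ℓ → Fin q) λ ex →
  Σ (Y → Fin ℓ → Fin q) λ ey →
  ∀ x y → (P x y ≡ true) ⇔ IPZero q ℓ (ex x) (ey y)

-- DI(P,q) ≤ k : since DI(P,q) is the minimum length of an encoding,
-- this holds iff some encoding of length ℓ ≤ k exists.
DI≤ : {X Y : Set} → (X → Y → Bool) → (q : ℕ) → ℕ → Set
DI≤ P q k = ∃[ ℓ ] (ℓ ≤ k × IPEncoding P q ℓ)

ETHR : (n t : ℕ) → Subset n → Subset n → Bool
ETHR n t S T = ∣ S ∩ T ∣ ≡ᵇ t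

-- |S ∩ T| = n ∸ k exactly when the complement ∁S ∪ ∁T of S ∩ T has k points.
-- Hence ETHR n n only asks whether S and T are both full, and ETHR n (n ∸ 1)
-- depends on S and T only through their gaps: no missing point, exactly one
-- missing point i, or several. Both relations on these finitely many shapes
-- are encoded by hand; the one-point case uses that i − j vanishes mod q only
-- for i = j once q > n, and all other pairings are arranged to be 0 or 1.
module Submission where

open import Defs
open import Data.Nat using (ℕ; zero; suc; _+_; _*_; _∸_; _≤_; _<_; _≡ᵇ_; z≤n; s≤s)
open import Data.Nat.Properties
open import Data.Nat.Divisibility using (_∣_; divides; _∣0; ∣-reflexive; >⇒∤)
open import Data.Fin as Fin using (Fin; zero; suc; toℕ; inject≤; opposite)
open import Data.Fin.Properties using (toℕ-injective; toℕ<n; toℕ-inject≤; opposite-prop)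
open import Data.Fin.Subset using (Subset; inside; outside; _∩_; ∁; ∣_∣)
open import Data.Fin.Subset.Properties using (∣∁p∣≡n∸∣p∣; ∣p∣≤n)
open import Data.Bool using (Bool; true; false; _∧_)
open import Data.Bool.Properties using (∧-zeroʳ)
open import Data.Vec using ([]; _∷_; lookup)
open import Data.Product using (_×_; _,_)
open import Function using (_∘_)
open import Function.Bundles using (_⇔_; mk⇔)
open import Function.Properties.Equivalence using () renaming (trans to ⇔-trans; sym to ⇔-sym)
open import Relation.Nullary using (Dec; yes; no; does; contradiction)
open import Relation.Nullary.Decidable using (does-⇔)
open import Relation.Binary.PropositionalEquality

private
  variable
    n q ℓ : ℕ

IPEncoding-pullback : {X Y X′ Y′ : Set} {P : X → Y → Bool} {P′ : X′ → Y′ → Bool}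
                      (f : X → X′) (g : Y → Y′) →
                      (∀ x y → P x y ≡ P′ (f x) (g y)) →
                      IPEncoding P′ q ℓ → IPEncoding P q ℓ
IPEncoding-pullback {q = q} {ℓ} f g P≡P′ (encˣ , encʸ , correct) =
  encˣ ∘ f , encʸ ∘ g , λ x y →
    subst (λ b → (b ≡ true) ⇔ IPZero q ℓ (encˣ (f x)) (encʸ (g y)))
          (sym (P≡P′ x y)) (correct (f x) (g y))

≡0⇒true⇔∣ : ∀ {m} → m ≡ 0 → (true ≡ true) ⇔ q ∣ m
≡0⇒true⇔∣ {q} refl = mk⇔ (λ _ → q ∣0) (λ _ → refl)

≡1⇒false⇔∣ : ∀ {m} → 1 < q → m ≡ 1 → (false ≡ true) ⇔ q ∣ m
≡1⇒false⇔∣ 1<q refl = mk⇔ (λ ()) (λ q∣1 → contradiction q∣1 (>⇒∤ 1<q))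

does≡true⇔ : {A : Set} (a? : Dec A) → (does a? ≡ true) ⇔ A
does≡true⇔ (yes a)  = mk⇔ (λ _ → a) (λ _ → refl)
does≡true⇔ (no ¬a) = mk⇔ (λ ()) (λ a → contradiction a ¬a)

≡∸⇔∸≡ : ∀ {a b} → a ≤ n → b ≤ n → (a ≡ n ∸ b) ⇔ (n ∸ a ≡ b)
≡∸⇔∸≡ {n} a≤n b≤n = mk⇔ (λ { refl → m∸[m∸n]≡n b≤n }) (λ { refl → sym (m∸[m∸n]≡n a≤n) })

ETHR-∸≡∣∁∩∣≡ᵇ : ∀ {k} → k ≤ n → (S T : Subset n) → ETHR n (n ∸ k) S T ≡ (∣ ∁ (S ∩ T) ∣ ≡ᵇ k)
ETHR-∸≡∣∁∩∣≡ᵇ {n} {k} k≤n S T =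
  does-⇔ (subst (λ c → (∣ S ∩ T ∣ ≡ n ∸ k) ⇔ (c ≡ k)) (sym (∣∁p∣≡n∸∣p∣ (S ∩ T)))
                (≡∸⇔∸≡ (∣p∣≤n (S ∩ T)) k≤n))
         (∣ S ∩ T ∣ ≟ n ∸ k) (∣ ∁ (S ∩ T) ∣ ≟ k)

data Gap (n : ℕ) : Set where
  none    : Gap n
  at      : Fin n → Gap n
  several : Gap n

shift : Gap n → Gap (suc n)
shift none    = none
shift (at i)  = at (suc i)
shift several = several

grow : Gap n → Gap (suc n)
grow none = at zero
grow _    = several

gap : Subset n → Gap n
gap []            = none
gap (inside  ∷ s) = shift (gap s)
gap (outside ∷ s) = grow (gap s)

isNone : Gap n → Bool
isNone none = true
isNone _    = false

singleGap : Gap n → Gap n → Bool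
singleGap none   (at _) = true
singleGap (at _) none   = true
singleGap (at i) (at j) = does (i Fin.≟ j)
singleGap _      _      = false

isNone-shift : (g : Gap n) → isNone (shift g) ≡ isNone g
isNone-shift none    = refl
isNone-shift (at _)  = refl
isNone-shift several = refl

isNone-grow : (g : Gap n) → isNone (grow g) ≡ false
isNone-grow none    = refl
isNone-grow (at _)  = refl
isNone-grow several = refl

singleGap-shift : (g h : Gap n) → singleGap (shift g) (shift h) ≡ singleGap g h
singleGap-shift none    none    = refl
singleGap-shift none    (at _)  = refl
singleGap-shift none    several = refl
singleGap-shift (at _)  none    = refl
singleGap-shift (at _)  (at _)  = refl
singleGap-shift (at _)  several = refl
singleGap-shift several _       = refl

singleGap-shift-grow : (g h : Gap n) → singleGap (shift g) (grow h) ≡ isNone g ∧ isNone h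
singleGap-shift-grow none    none    = refl
singleGap-shift-grow none    (at _)  = refl
singleGap-shift-grow none    several = refl
singleGap-shift-grow (at _)  none    = refl
singleGap-shift-grow (at _)  (at _)  = refl
singleGap-shift-grow (at _)  several = refl
singleGap-shift-grow several _       = refl

singleGap-grow-shift : (g h : Gap n) → singleGap (grow g) (shift h) ≡ isNone g ∧ isNone h
singleGap-grow-shift none    none    = refl
singleGap-grow-shift none    (at _)  = refl
singleGap-grow-shift none    several = refl
singleGap-grow-shift (at _)  _       = refl
singleGap-grow-shift several _       = refl

singleGap-grow : (g h : Gap n) → singleGap (grow g) (grow h) ≡ isNone g ∧ isNone h
singleGap-grow none    none    = refl
singleGap-grow none    (at _)  = refl
singleGap-grow none    several = refl
singleGap-grow (at _)  _       = refl
singleGap-grow several _       = refl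

∣∁∩∣≡ᵇ0 : (s t : Subset n) → (∣ ∁ (s ∩ t) ∣ ≡ᵇ 0) ≡ isNone (gap s) ∧ isNone (gap t)
∣∁∩∣≡ᵇ0 []            []            = refl
∣∁∩∣≡ᵇ0 (inside  ∷ s) (inside  ∷ t)
  rewrite isNone-shift (gap s) | isNone-shift (gap t) = ∣∁∩∣≡ᵇ0 s t
∣∁∩∣≡ᵇ0 (inside  ∷ s) (outside ∷ t)
  rewrite isNone-grow (gap t) = sym (∧-zeroʳ (isNone (shift (gap s))))
∣∁∩∣≡ᵇ0 (outside ∷ s) (_       ∷ t)
  rewrite isNone-grow (gap s) = refl

∣∁∩∣≡ᵇ1 : (s t : Subset n) → (∣ ∁ (s ∩ t) ∣ ≡ᵇ 1) ≡ singleGap (gap s) (gap t)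
∣∁∩∣≡ᵇ1 []            []            = refl
∣∁∩∣≡ᵇ1 (inside  ∷ s) (inside  ∷ t) =
  trans (∣∁∩∣≡ᵇ1 s t) (sym (singleGap-shift (gap s) (gap t)))
∣∁∩∣≡ᵇ1 (inside  ∷ s) (outside ∷ t) =
  trans (∣∁∩∣≡ᵇ0 s t) (sym (singleGap-shift-grow (gap s) (gap t)))
∣∁∩∣≡ᵇ1 (outside ∷ s) (inside  ∷ t) =
  trans (∣∁∩∣≡ᵇ0 s t) (sym (singleGap-grow-shift (gap s) (gap t)))
∣∁∩∣≡ᵇ1 (outside ∷ s) (outside ∷ t) =
  trans (∣∁∩∣≡ᵇ0 s t) (sym (singleGap-grow (gap s) (gap t)))

d∣m∧0<m∧m<d+d⇒m≡d : ∀ {d m} → d ∣ m → 0 < m → m < d + d → m ≡ d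
d∣m∧0<m∧m<d+d⇒m≡d         (divides 0             refl) ()
d∣m∧0<m∧m<d+d⇒m≡d {d}     (divides 1             refl) _ _ = +-identityʳ d
d∣m∧0<m∧m<d+d⇒m≡d {d} {m} (divides (suc (suc c)) refl) _ m<d+d =
  contradiction (+-monoʳ-≤ d (m≤m+n d (c * d))) (<⇒≱ m<d+d)

∣∸+suc⇔≡ : ∀ {m a b} → a ≤ m → b ≤ m → (suc m ∣ (m ∸ b) + suc a) ⇔ (a ≡ b)
∣∸+suc⇔≡ {m} {a} {b} a≤m b≤m = mk⇔ to (λ { refl → ∣-reflexive (sym (∸+suc≡suc a≤m)) })
  where
  ∸+suc≡suc : ∀ {c} → c ≤ m → (m ∸ c) + suc c ≡ suc m
  ∸+suc≡suc {c} c≤m = trans (+-suc (m ∸ c) c) (cong suc (m∸n+n≡m c≤m))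

  to : suc m ∣ (m ∸ b) + suc a → a ≡ b
  to m+1∣ = suc-injective (+-cancelˡ-≡ (m ∸ b) (suc a) (suc b)
    (trans (d∣m∧0<m∧m<d+d⇒m≡d m+1∣ positive bounded) (sym (∸+suc≡suc b≤m))))
    where
    positive : 0 < (m ∸ b) + suc a
    positive = subst (0 <_) (sym (+-suc (m ∸ b) a)) (s≤s z≤n)
    bounded : (m ∸ b) + suc a < suc m + suc m
    bounded = +-mono-<-≤ (s≤s (m∸n≤m m b)) (s≤s a≤m)

∧-encoding : 1 < q → IPEncoding _∧_ q 2
∧-encoding {q@(suc (suc _))} 1<q@(s≤s (s≤s _)) = encˣ , encʸ , correct
  where
  encˣ encʸ : Bool → Fin 2 → Fin q
  encˣ true  = lookup (zero ∷ suc zero ∷ [])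
  encˣ false = lookup (suc zero ∷ zero ∷ [])
  encʸ true  = lookup (suc zero ∷ zero ∷ [])
  encʸ false = lookup (suc zero ∷ suc zero ∷ [])

  correct : ∀ a b → (a ∧ b ≡ true) ⇔ IPZero q 2 (encˣ a) (encʸ b)
  correct true  true  = ≡0⇒true⇔∣ refl
  correct true  false = ≡1⇒false⇔∣ 1<q refl
  correct false true  = ≡1⇒false⇔∣ 1<q refl
  correct false false = ≡1⇒false⇔∣ 1<q refl

singleGap-encoding : n < q → 1 < q → IPEncoding (singleGap {n}) q 3
singleGap-encoding {n} {q@(suc q′)} (s≤s n≤q′) 1<q@(s≤s (s≤s _)) = encˣ , encʸ , correct
  where
  n≤q : n ≤ q
  n≤q = m≤n⇒m≤1+n n≤q′

  encˣ encʸ : Gap n → Fin 3 → Fin q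
  encˣ none    = lookup (zero ∷ zero ∷ suc zero ∷ [])
  encˣ (at i)  = lookup (suc zero ∷ suc (inject≤ i n≤q′) ∷ zero ∷ [])
  encˣ several = lookup (zero ∷ suc zero ∷ suc zero ∷ [])
  encʸ none    = lookup (zero ∷ zero ∷ suc zero ∷ [])
  -- opposite (inject≤ j _) is −(j + 1) mod q, so at i and at j pair to i − j.
  encʸ (at j)  = lookup (opposite (inject≤ j n≤q) ∷ suc zero ∷ zero ∷ [])
  encʸ several = lookup (suc zero ∷ zero ∷ suc zero ∷ [])

  *0+0≡0 : ∀ m → m * 0 + 0 ≡ 0
  *0+0≡0 m = trans (+-identityʳ (m * 0)) (*-zeroʳ m)

  toℕ≤q′ : (i : Fin n) → toℕ i ≤ q′
  toℕ≤q′ i = ≤-trans (<⇒≤ (toℕ<n i)) n≤q′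

  pairing-at : ∀ i j → sumFin 3 (λ k → toℕ (encˣ (at i) k) * toℕ (encʸ (at j) k))
                       ≡ (q′ ∸ toℕ j) + suc (toℕ i)
  pairing-at i j = cong₂ _+_
    (trans (+-identityʳ _) (trans (opposite-prop (inject≤ j n≤q)) (cong (q′ ∸_) (toℕ-inject≤ j n≤q))))
    (trans (+-identityʳ _) (trans (*-identityʳ _) (cong suc (toℕ-inject≤ i n≤q′))))

  IPZero-at : ∀ i j → IPZero q 3 (encˣ (at i)) (encʸ (at j)) ⇔ (i ≡ j)
  IPZero-at i j = subst (λ v → (q ∣ v) ⇔ (i ≡ j)) (sym (pairing-at i j))
    (⇔-trans (∣∸+suc⇔≡ (toℕ≤q′ i) (toℕ≤q′ j)) (mk⇔ toℕ-injective (cong toℕ)))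

  correct : ∀ g h → (singleGap g h ≡ true) ⇔ IPZero q 3 (encˣ g) (encʸ h)
  correct none    none    = ≡1⇒false⇔∣ 1<q refl
  correct none    (at _)  = ≡0⇒true⇔∣ refl
  correct none    several = ≡1⇒false⇔∣ 1<q refl
  correct (at i)  none    = ≡0⇒true⇔∣ (*0+0≡0 (toℕ (inject≤ i n≤q′)))
  correct (at i)  (at j)  = ⇔-trans (does≡true⇔ (i Fin.≟ j)) (⇔-sym (IPZero-at i j))
  correct (at i)  several = ≡1⇒false⇔∣ 1<q (cong suc (*0+0≡0 (toℕ (inject≤ i n≤q′))))
  correct several none    = ≡1⇒false⇔∣ 1<q refl
  correct several (at _)  = ≡1⇒false⇔∣ 1<q refl
  correct several several = ≡1⇒false⇔∣ 1<q refl

mainTheorem7 : (∀ (n q : ℕ) → 1 ≤ n → 2 ≤ q → DI≤ (ETHR n n) q 2)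
    × (∀ (n q : ℕ) → 2 ≤ n → n + 2 ≤ q → DI≤ (ETHR n (n ∸ 1)) q 3)
mainTheorem7 = full , missingOne
  where
  full : ∀ n q → 1 ≤ n → 2 ≤ q → DI≤ (ETHR n n) q 2
  full n q _ 2≤q = 2 , ≤-refl ,
    IPEncoding-pullback (isNone ∘ gap) (isNone ∘ gap)
      (λ S T → trans (ETHR-∸≡∣∁∩∣≡ᵇ z≤n S T) (∣∁∩∣≡ᵇ0 S T))
      (∧-encoding 2≤q)

  missingOne : ∀ n q → 2 ≤ n → n + 2 ≤ q → DI≤ (ETHR n (n ∸ 1)) q 3
  missingOne n q 2≤n n+2≤q = 3 , ≤-refl ,
    IPEncoding-pullback gap gap
      (λ S T → trans (ETHR-∸≡∣∁∩∣≡ᵇ (≤-trans (s≤s z≤n) 2≤n) S T) (∣∁∩∣≡ᵇ1 S T))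
      (singleGap-encoding (≤-trans (m<m+n n (s≤s z≤n)) n+2≤q) (≤-trans (m≤n+m 2 n) n+2≤q))
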